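{- For every integer $j\ge0$, in $\mathbb{Z}[q][[y]]$, $$(-1)^jq^{ -\binom{j+1}{2}}y^{ -j}\sum_{i\ge j}(-1)^iq^{\binom{i+1}{2}}\begin{bmatrix} i\\ j\end{bmatrix}y^i\prod_{r=1}^{i+1}\frac{1}{1-q^{r+j}y}=1.$$
   Context: $[m]=1+q+\dots+q^{m-1}$, $[m]!=\prod_{s=1}^m[s]$, and $\begin{bmatrix} i\\ j\end{bmatrix}=\frac{[i]!}{[j]![i-j]!}$ is the Gaussian ($q$-)binomial coefficient. The factors $1/(1-q^{r+j}y)$ are expanded as geometric series in $y$. -}

module Defs where

open import Data.Nat as ℕ using (ℕ; zero; suc; _∸_; _≡ᵇ_)
open import Data.Bool using (if_then_else_)
open import Data.Integer as ℤ using (ℤ; 0ℤ; 1ℤ)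
open import Relation.Binary.PropositionalEquality using (_≡_)

sumℤ : ℕ → (ℕ → ℤ) → ℤ
sumℤ zero    f = 0ℤ
sumℤ (suc n) f = sumℤ n f ℤ.+ f n

negPow : ℕ → ℤ
negPow zero    = 1ℤ
negPow (suc k) = ℤ.- negPow k

-- Coefficient ring Z[q], represented by coefficient sequences in q
-- (p m = coefficient of q^m).  All elements built below are polynomials.

Pol : Set
Pol = ℕ → ℤ

_≈P_ : Pol → Pol → Set
f ≈P g = ∀ m → f m ≡ g m

constP : ℤ → Pol
constP c zero    = c
constP c (suc m) = 0ℤ

0P 1P : Pol
0P = constP 0ℤ
1P = constP 1ℤ

qpow : ℕ → Pol
qpow e m = if m ≡ᵇ e then 1ℤ else 0ℤ

_+P_ : Pol → Pol → Pol
(f +P g) m = f m ℤ.+ g m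

_*P_ : Pol → Pol → Pol
(f *P g) m = sumℤ (suc m) (λ a → f a ℤ.* g (m ∸ a))

infixl 6 _+P_
infixl 7 _*P_
infix 4 _≈P_ _≈S_

sumP : ℕ → (ℕ → Pol) → Pol
sumP zero    F = 0P
sumP (suc n) F = sumP n F +P F n

qint : ℕ → Pol
qint zero    = 0P
qint (suc m) = qint m +P qpow m

qfact : ℕ → Pol
qfact zero    = 1P
qfact (suc m) = qfact m *P qint (suc m)

-- Formal power series Z[q][[y]]:  s n = coefficient of y^n

PS : Set
PS = ℕ → Pol

_≈S_ : PS → PS → Set
f ≈S g = ∀ n → f n ≈P g n

1S : PS
1S zero    = 1P
1S (suc n) = 0P

_*S_ : PS → PS → PS
(f *S g) n = sumP (suc n) (λ a → f a *P g (n ∸ a))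

infixl 7 _*S_

scaleS : Pol → PS → PS
scaleS c f n = c *P f n

-- 1/(1 - q^e y) expanded as the geometric series Σ_n q^(e n) y^n
geomS : ℕ → PS
geomS e n = qpow (e ℕ.* n)

prodS : ℕ → (ℕ → PS) → PS
prodS zero    F = 1S
prodS (suc N) F = prodS N F *S F (suc N)

-- the (y-adically convergent) infinite sum  Σ_{k ≥ 0} y^k A_k
sumY : (ℕ → PS) → PS
sumY A n = sumP (suc n) (λ k → A k (n ∸ k))

{-# OPTIONS --safe #-}
-- The hypothesis forces G (j + k) = [j+k choose j], because q-factorials have constant term 1
-- and can be cancelled in ℤ[q].  The coefficient of y^l in ∏_{r=1}^{j+k+1} 1/(1 - q^(r+j) y)
-- is q^(l(j+1)) [j+k+l choose l], and C(j+k+1,2) - C(j+1,2) = k(j+1) + C(k,2).  Since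
-- [j+k choose j] [j+k+l choose l] = [j+k+l choose j] [k+l choose k], the coefficient of y^n in
-- the whole sum is q^(n(j+1)) [n+j choose j] ∑_k (-1)^k q^(C(k,2)) [n choose k], and this
-- alternating sum vanishes for n > 0.
module Submission where

open import Algebra.Bundles using (CommutativeRing)
import Algebra.Construct.Pointwise as Pointwise
import Algebra.Properties.CommutativeSemigroup as CommutativeSemigroupProperties
import Algebra.Properties.Ring as RingProperties
import Algebra.Properties.CommutativeSemiring.Exp as ExpProperties
import Algebra.Solver.Ring.NaturalCoefficients.Default as RingSolver
open import Data.Nat as ℕ using (ℕ; zero; suc; _∸_; _<_; _≤_; z≤n; s≤s)
open import Data.Nat.Combinatorics using (_C_; nC1≡n; nCk+nC[k+1]≡[n+1]C[k+1])
import Data.Nat.Properties as ℕ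
import Data.Nat.Solver as ℕ-Solver
open import Data.Nat.Induction using (<-rec)
open import Data.Product using (_,_)
open import Relation.Binary.PropositionalEquality as ≡ using (_≡_)

suc[n]C2≡n+nC2 : ∀ n → suc n C 2 ≡ n ℕ.+ n C 2
suc[n]C2≡n+nC2 n = ≡.trans (≡.sym (nCk+nC[k+1]≡[n+1]C[k+1] n 1)) (≡.cong (ℕ._+ n C 2) (nC1≡n n))

[m+n]C2≡mC2+n*m+nC2 : ∀ m n → (m ℕ.+ n) C 2 ≡ m C 2 ℕ.+ (n ℕ.* m ℕ.+ n C 2)
[m+n]C2≡mC2+n*m+nC2 m zero    = ≡.trans (≡.cong (_C 2) (ℕ.+-identityʳ m)) (≡.sym (ℕ.+-identityʳ _))
[m+n]C2≡mC2+n*m+nC2 m (suc n) = begin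
  (m ℕ.+ suc n) C 2
    ≡⟨ ≡.cong (_C 2) (ℕ.+-suc m n) ⟩
  suc (m ℕ.+ n) C 2
    ≡⟨ suc[n]C2≡n+nC2 (m ℕ.+ n) ⟩
  m ℕ.+ n ℕ.+ (m ℕ.+ n) C 2
    ≡⟨ ≡.cong (m ℕ.+ n ℕ.+_) ([m+n]C2≡mC2+n*m+nC2 m n) ⟩
  m ℕ.+ n ℕ.+ (m C 2 ℕ.+ (n ℕ.* m ℕ.+ n C 2))
    ≡⟨ solve 4 (λ m n mC2 nC2 → m :+ n :+ (mC2 :+ (n :* m :+ nC2)) := mC2 :+ ((con 1 :+ n) :* m :+ (n :+ nC2)))
               ≡.refl m n (m C 2) (n C 2) ⟩
  m C 2 ℕ.+ (suc n ℕ.* m ℕ.+ (n ℕ.+ n C 2))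
    ≡⟨ ≡.cong (λ t → m C 2 ℕ.+ (suc n ℕ.* m ℕ.+ t)) (suc[n]C2≡n+nC2 n) ⟨
  m C 2 ℕ.+ (suc n ℕ.* m ℕ.+ suc n C 2) ∎
  where
  open ≡.≡-Reasoning
  open ℕ-Solver.+-*-Solver

[j+k+1]C2∸[j+1]C2≡k*[1+j]+kC2 : ∀ j k → (j ℕ.+ k ℕ.+ 1) C 2 ∸ (j ℕ.+ 1) C 2 ≡ k ℕ.* suc j ℕ.+ k C 2
[j+k+1]C2∸[j+1]C2≡k*[1+j]+kC2 j k = begin
  (j ℕ.+ k ℕ.+ 1) C 2 ∸ (j ℕ.+ 1) C 2
    ≡⟨ ≡.cong₂ (λ m n → m C 2 ∸ n C 2) (ℕ.+-comm (j ℕ.+ k) 1) (ℕ.+-comm j 1) ⟩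
  (suc j ℕ.+ k) C 2 ∸ suc j C 2
    ≡⟨ ≡.cong (_∸ suc j C 2) ([m+n]C2≡mC2+n*m+nC2 (suc j) k) ⟩
  suc j C 2 ℕ.+ (k ℕ.* suc j ℕ.+ k C 2) ∸ suc j C 2
    ≡⟨ ℕ.m+n∸m≡n (suc j C 2) _ ⟩
  k ℕ.* suc j ℕ.+ k C 2 ∎
  where open ≡.≡-Reasoning

-- ∑ is a parameter rather than a definition so that sumℤ and sumP are instances of it on
-- the nose: _*P_ and _*S_ then are, definitionally, the convolution product _⊛_ below.
module Summation {c ℓ} (R : CommutativeRing c ℓ)
  (∑ : ℕ → (ℕ → CommutativeRing.Carrier R) → CommutativeRing.Carrier R)
  (∑-zero : ∀ f → CommutativeRing._≈_ R (∑ 0 f) (CommutativeRing.0# R))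
  (∑-suc : ∀ n f → CommutativeRing._≈_ R (∑ (suc n) f) (CommutativeRing._+_ R (∑ n f) (f n)))
  where

  open CommutativeRing R

  open RingProperties ring using (-‿+-comm; -0#≈0#; +-cancelʳ)
  open CommutativeSemigroupProperties +-commutativeSemigroup using ()
    renaming (interchange to +-interchange; x∙yz≈y∙xz to x+[y+z]≈y+[x+z])
  open import Relation.Binary.Reasoning.Setoid setoid

  ∑-cong-< : ∀ n {f g} → (∀ a → a < n → f a ≈ g a) → ∑ n f ≈ ∑ n g
  ∑-cong-< zero    f≈g = trans (∑-zero _) (sym (∑-zero _))
  ∑-cong-< (suc n) f≈g = trans (∑-suc n _) (trans
    (+-cong (∑-cong-< n (λ a a<n → f≈g a (ℕ.m<n⇒m<1+n a<n))) (f≈g n ℕ.≤-refl))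
    (sym (∑-suc n _)))

  ∑-cong : ∀ n {f g} → (∀ a → f a ≈ g a) → ∑ n f ≈ ∑ n g
  ∑-cong n f≈g = ∑-cong-< n (λ a _ → f≈g a)

  ∑-1 : ∀ f → ∑ 1 f ≈ f 0
  ∑-1 f = trans (∑-suc 0 f) (trans (+-congʳ (∑-zero f)) (+-identityˡ _))

  ∑-0# : ∀ n → ∑ n (λ _ → 0#) ≈ 0#
  ∑-0# zero    = ∑-zero _
  ∑-0# (suc n) = trans (∑-suc n _) (trans (+-congʳ (∑-0# n)) (+-identityˡ 0#))

  ∑-distrib-+ : ∀ n f g → ∑ n (λ a → f a + g a) ≈ ∑ n f + ∑ n g
  ∑-distrib-+ zero    f g = trans (∑-zero _) (sym (trans (+-cong (∑-zero f) (∑-zero g)) (+-identityˡ 0#)))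
  ∑-distrib-+ (suc n) f g = begin
    ∑ (suc n) (λ a → f a + g a)          ≈⟨ ∑-suc n _ ⟩
    ∑ n (λ a → f a + g a) + (f n + g n)  ≈⟨ +-congʳ (∑-distrib-+ n f g) ⟩
    (∑ n f + ∑ n g) + (f n + g n)        ≈⟨ +-interchange _ _ _ _ ⟩
    (∑ n f + f n) + (∑ n g + g n)        ≈⟨ +-cong (∑-suc n f) (∑-suc n g) ⟨
    ∑ (suc n) f + ∑ (suc n) g            ∎

  *-distribˡ-∑ : ∀ n x f → x * ∑ n f ≈ ∑ n (λ a → x * f a)
  *-distribˡ-∑ zero    x f = trans (*-congˡ (∑-zero f)) (trans (zeroʳ x) (sym (∑-zero _)))
  *-distribˡ-∑ (suc n) x f = begin
    x * ∑ (suc n) f               ≈⟨ *-congˡ (∑-suc n f) ⟩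
    x * (∑ n f + f n)             ≈⟨ distribˡ x _ _ ⟩
    x * ∑ n f + x * f n           ≈⟨ +-congʳ (*-distribˡ-∑ n x f) ⟩
    ∑ n (λ a → x * f a) + x * f n ≈⟨ ∑-suc n _ ⟨
    ∑ (suc n) (λ a → x * f a)     ∎

  -‿distrib-∑ : ∀ n f → ∑ n (λ a → - f a) ≈ - ∑ n f
  -‿distrib-∑ zero    f = trans (∑-zero _) (trans (sym -0#≈0#) (-‿cong (sym (∑-zero f))))
  -‿distrib-∑ (suc n) f = begin
    ∑ (suc n) (λ a → - f a)       ≈⟨ ∑-suc n _ ⟩
    ∑ n (λ a → - f a) + - f n     ≈⟨ +-congʳ (-‿distrib-∑ n f) ⟩
    - ∑ n f + - f n               ≈⟨ -‿+-comm _ _ ⟩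
    - (∑ n f + f n)               ≈⟨ -‿cong (∑-suc n f) ⟨
    - ∑ (suc n) f                 ∎

  ∑-sucˡ : ∀ n f → ∑ (suc n) f ≈ f 0 + ∑ n (λ a → f (suc a))
  ∑-sucˡ zero    f = begin
    ∑ 1 f                       ≈⟨ ∑-1 f ⟩
    f 0                         ≈⟨ +-identityʳ _ ⟨
    f 0 + 0#                    ≈⟨ +-congˡ (∑-zero _) ⟨
    f 0 + ∑ 0 (λ a → f (suc a)) ∎
  ∑-sucˡ (suc n) f = begin
    ∑ (suc (suc n)) f                                ≈⟨ ∑-suc (suc n) f ⟩
    ∑ (suc n) f + f (suc n)                          ≈⟨ +-congʳ (∑-sucˡ n f) ⟩
    (f 0 + ∑ n (λ a → f (suc a))) + f (suc n)        ≈⟨ +-assoc _ _ _ ⟩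
    f 0 + (∑ n (λ a → f (suc a)) + f (suc n))        ≈⟨ +-congˡ (∑-suc n _) ⟨
    f 0 + ∑ (suc n) (λ a → f (suc a))                ∎

  ∑-reverse : ∀ m (F : ℕ → ℕ → Carrier) → ∑ (suc m) (λ a → F a (m ∸ a)) ≈ ∑ (suc m) (λ a → F (m ∸ a) a)
  ∑-reverse zero    F = ∑-cong-< 1 λ { 0 _ → refl ; (suc _) (s≤s ()) }
  ∑-reverse (suc m) F = begin
    ∑ (suc (suc m)) (λ a → F a (suc m ∸ a))                ≈⟨ ∑-sucˡ (suc m) _ ⟩
    F 0 (suc m) + ∑ (suc m) (λ a → F (suc a) (m ∸ a))      ≈⟨ +-congˡ (∑-reverse m (λ a → F (suc a))) ⟩
    F 0 (suc m) + ∑ (suc m) (λ a → F (suc (m ∸ a)) a)      ≈⟨ +-congˡ (∑-cong-< (suc m) λ a a≤m →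
                                                                 reflexive (≡.cong (λ b → F b a) (ℕ.+-∸-assoc 1 (ℕ.≤-pred a≤m)))) ⟨
    F 0 (suc m) + ∑ (suc m) (λ a → F (suc m ∸ a) a)        ≈⟨ +-comm _ _ ⟩
    ∑ (suc m) (λ a → F (suc m ∸ a) a) + F 0 (suc m)        ≈⟨ +-congˡ (reflexive (≡.cong (λ b → F b (suc m)) (ℕ.n∸n≡0 m))) ⟨
    ∑ (suc m) (λ a → F (suc m ∸ a) a) + F (m ∸ m) (suc m)  ≈⟨ ∑-suc (suc m) _ ⟨
    ∑ (suc (suc m)) (λ a → F (suc m ∸ a) a)                ∎

  module PowerSeries where

    Series : Set c
    Series = ℕ → Carrier

    infix  4 _≋_
    infixl 6 _⊕_
    infixl 7 _⊛_ _·_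

    _≋_ : Series → Series → Set ℓ
    f ≋ g = ∀ m → f m ≈ g m

    _⊕_ : Series → Series → Series
    (f ⊕ g) m = f m + g m

    ⊝_ : Series → Series
    (⊝ f) m = - f m

    𝟘 𝟙 X : Series
    𝟘 _ = 0#
    𝟙 zero    = 1#
    𝟙 (suc _) = 0#
    X 1 = 1#
    X _ = 0#

    _⊛_ : Series → Series → Series
    (f ⊛ g) m = ∑ (suc m) (λ a → f a * g (m ∸ a))

    _·_ : Carrier → Series → Series
    (x · g) m = x * g m

    tail : Series → Series
    tail f m = f (suc m)

    ⊛-cong : ∀ {f f′ g g′} → f ≋ f′ → g ≋ g′ → f ⊛ g ≋ f′ ⊛ g′
    ⊛-cong f≋f′ g≋g′ m = ∑-cong (suc m) (λ a → *-cong (f≋f′ a) (g≋g′ (m ∸ a)))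

    ⊛-congʳ : ∀ h {f g} → f ≋ g → f ⊛ h ≋ g ⊛ h
    ⊛-congʳ h f≋g = ⊛-cong {g = h} {g′ = h} f≋g (λ _ → refl)

    ⊛-comm : ∀ f g → f ⊛ g ≋ g ⊛ f
    ⊛-comm f g m = trans (∑-reverse m (λ a b → f a * g b)) (∑-cong (suc m) (λ a → *-comm _ _))

    ⊛-constant : ∀ f g → (f ⊛ g) 0 ≈ f 0 * g 0
    ⊛-constant f g = ∑-1 _

    tail-⊛ : ∀ f g → tail (f ⊛ g) ≋ f 0 · tail g ⊕ tail f ⊛ g
    tail-⊛ f g m = ∑-sucˡ (suc m) _

    ⊛-identityˡ : ∀ f → 𝟙 ⊛ f ≋ f
    ⊛-identityˡ f m = begin
      (𝟙 ⊛ f) m                                   ≈⟨ ∑-sucˡ m _ ⟩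
      1# * f m + ∑ m (λ a → 0# * f (m ∸ suc a))   ≈⟨ +-cong (*-identityˡ _) (∑-cong m (λ a → zeroˡ _)) ⟩
      f m + ∑ m (λ _ → 0#)                        ≈⟨ +-congˡ (∑-0# m) ⟩
      f m + 0#                                    ≈⟨ +-identityʳ _ ⟩
      f m                                         ∎

    ⊛-identityʳ : ∀ f → f ⊛ 𝟙 ≋ f
    ⊛-identityʳ f m = trans (⊛-comm f 𝟙 m) (⊛-identityˡ f m)

    ⊛-distribˡ : ∀ f g h → f ⊛ (g ⊕ h) ≋ f ⊛ g ⊕ f ⊛ h
    ⊛-distribˡ f g h m = trans (∑-cong (suc m) (λ a → distribˡ _ _ _)) (∑-distrib-+ (suc m) _ _)

    ⊛-distribʳ : ∀ f g h → (g ⊕ h) ⊛ f ≋ g ⊛ f ⊕ h ⊛ f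
    ⊛-distribʳ f g h m = trans (∑-cong (suc m) (λ a → distribʳ _ _ _)) (∑-distrib-+ (suc m) _ _)

    ·-⊛ : ∀ x g h → (x · g) ⊛ h ≋ x · (g ⊛ h)
    ·-⊛ x g h m = trans (∑-cong (suc m) (λ a → *-assoc _ _ _)) (sym (*-distribˡ-∑ (suc m) x _))

    -- Induction on the coefficient index through tail-⊛ avoids reindexing a double sum.
    ⊛-assoc : ∀ f g h → (f ⊛ g) ⊛ h ≋ f ⊛ (g ⊛ h)
    ⊛-assoc f g h zero = begin
      ((f ⊛ g) ⊛ h) 0      ≈⟨ trans (⊛-constant (f ⊛ g) h) (*-congʳ (⊛-constant f g)) ⟩
      (f 0 * g 0) * h 0    ≈⟨ *-assoc _ _ _ ⟩
      f 0 * (g 0 * h 0)    ≈⟨ trans (⊛-constant f (g ⊛ h)) (*-congˡ (⊛-constant g h)) ⟨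
      (f ⊛ (g ⊛ h)) 0      ∎
    ⊛-assoc f g h (suc m) = begin
      ((f ⊛ g) ⊛ h) (suc m)
        ≈⟨ tail-⊛ (f ⊛ g) h m ⟩
      (f ⊛ g) 0 * h (suc m) + (tail (f ⊛ g) ⊛ h) m
        ≈⟨ +-cong (*-congʳ (⊛-constant f g)) (⊛-congʳ h (tail-⊛ f g) m) ⟩
      (f 0 * g 0) * h (suc m) + ((f 0 · tail g ⊕ tail f ⊛ g) ⊛ h) m
        ≈⟨ +-cong (*-assoc _ _ _) (trans (⊛-distribʳ h _ _ m)
             (+-cong (·-⊛ (f 0) (tail g) h m) (⊛-assoc (tail f) g h m))) ⟩
      f 0 * (g 0 * h (suc m)) + (f 0 * (tail g ⊛ h) m + (tail f ⊛ (g ⊛ h)) m)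
        ≈⟨ trans (+-congʳ (distribˡ _ _ _)) (+-assoc _ _ _) ⟨
      f 0 * (g 0 * h (suc m) + (tail g ⊛ h) m) + (tail f ⊛ (g ⊛ h)) m
        ≈⟨ +-congʳ (*-congˡ (tail-⊛ g h m)) ⟨
      f 0 * (g ⊛ h) (suc m) + (tail f ⊛ (g ⊛ h)) m
        ≈⟨ tail-⊛ f (g ⊛ h) m ⟨
      (f ⊛ (g ⊛ h)) (suc m) ∎

    commutativeRing : CommutativeRing c ℓ
    commutativeRing = record
      { Carrier = Series ; _≈_ = _≋_ ; _+_ = _⊕_ ; _*_ = _⊛_ ; -_ = ⊝_ ; 0# = 𝟘 ; 1# = 𝟙
      ; isCommutativeRing = record
        { isRing = record
          { +-isAbelianGroup = Pointwise.isAbelianGroup ℕ +-isAbelianGroup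
          ; *-cong           = ⊛-cong
          ; *-assoc          = ⊛-assoc
          ; *-identity       = ⊛-identityˡ , ⊛-identityʳ
          ; distrib          = ⊛-distribˡ , ⊛-distribʳ
          }
        ; *-comm = ⊛-comm
        }
      }

    ⊛-cancelˡ : ∀ {f g h} → f 0 ≈ 1# → f ⊛ g ≋ f ⊛ h → g ≋ h
    ⊛-cancelˡ {f} {g} {h} f₀≈1 fg≋fh = <-rec (λ m → g m ≈ h m) step
      where
      step : ∀ m → (∀ {k} → k < m → g k ≈ h k) → g m ≈ h m
      step m ih = begin
        g m        ≈⟨ trans (*-congʳ f₀≈1) (*-identityˡ _) ⟨
        f 0 * g m  ≈⟨ +-cancelʳ _ _ _ (begin
          f 0 * g m + ∑ m (λ a → f (suc a) * h (m ∸ suc a))  ≈⟨ +-congˡ (∑-cong-< m λ a a<m →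
                                                                  *-congˡ (ih (ℕ.∸-monoʳ-< (s≤s z≤n) a<m))) ⟨
          f 0 * g m + ∑ m (λ a → f (suc a) * g (m ∸ suc a))  ≈⟨ ∑-sucˡ m _ ⟨
          (f ⊛ g) m                                           ≈⟨ fg≋fh m ⟩
          (f ⊛ h) m                                           ≈⟨ ∑-sucˡ m _ ⟩
          f 0 * h m + ∑ m (λ a → f (suc a) * h (m ∸ suc a))  ∎) ⟩
        f 0 * h m  ≈⟨ trans (*-congʳ f₀≈1) (*-identityˡ _) ⟩
        h m        ∎

    X⊛-constant : ∀ g → (X ⊛ g) 0 ≈ 0#
    X⊛-constant g = trans (⊛-constant X g) (zeroˡ (g 0))

    X⊛-suc : ∀ g m → (X ⊛ g) (suc m) ≈ g m
    X⊛-suc g m = begin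
      (X ⊛ g) (suc m)                     ≈⟨ tail-⊛ X g m ⟩
      0# * g (suc m) + (tail X ⊛ g) m     ≈⟨ +-cong (zeroˡ _) (⊛-congʳ g tail-X≋𝟙 m) ⟩
      0# + (𝟙 ⊛ g) m                      ≈⟨ trans (+-identityˡ _) (⊛-identityˡ g m) ⟩
      g m                                 ∎
      where
      tail-X≋𝟙 : tail X ≋ 𝟙
      tail-X≋𝟙 zero    = refl
      tail-X≋𝟙 (suc m) = refl

    ∏ : ℕ → (ℕ → Series) → Series
    ∏ zero    F = 𝟙
    ∏ (suc N) F = ∏ N F ⊛ F (suc N)

  module Gaussian (q : Carrier) where

    open PowerSeries using (Series; 𝟙; ∏)
    open ExpProperties commutativeSemiring using (_^_; ^-homo-*; ^-congʳ)
    open RingProperties ring using (-1*x≈-x; -‿involutive; -‿distribˡ-*; -‿distribʳ-*)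
    open CommutativeSemigroupProperties *-commutativeSemigroup using (xy∙z≈xz∙y; x∙yz≈y∙xz; x∙yz≈yx∙z)

    [_] : ℕ → Carrier
    [ zero  ] = 0#
    [ suc m ] = [ m ] + q ^ m

    [_]! : ℕ → Carrier
    [ zero  ]! = 1#
    [ suc m ]! = [ m ]! * [ suc m ]

    qbinom : ℕ → ℕ → Carrier
    qbinom n       zero    = 1#
    qbinom zero    (suc k) = 0#
    qbinom (suc n) (suc k) = qbinom n k + q ^ suc k * qbinom n (suc k)

    qbinom₂ : ℕ → ℕ → Carrier
    qbinom₂ a b = qbinom (a ℕ.+ b) a

    geometric : ℕ → Series
    geometric e n = q ^ (e ℕ.* n)

    [a+b]≈[a]+q^a*[b] : ∀ a b → [ a ℕ.+ b ] ≈ [ a ] + q ^ a * [ b ]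
    [a+b]≈[a]+q^a*[b] a zero    = begin
      [ a ℕ.+ 0 ]        ≈⟨ reflexive (≡.cong [_] (ℕ.+-identityʳ a)) ⟩
      [ a ]              ≈⟨ +-identityʳ _ ⟨
      [ a ] + 0#         ≈⟨ +-congˡ (zeroʳ _) ⟨
      [ a ] + q ^ a * 0# ∎
    [a+b]≈[a]+q^a*[b] a (suc b) = begin
      [ a ℕ.+ suc b ]                              ≈⟨ reflexive (≡.cong [_] (ℕ.+-suc a b)) ⟩
      [ a ℕ.+ b ] + q ^ (a ℕ.+ b)                  ≈⟨ +-cong ([a+b]≈[a]+q^a*[b] a b) (^-homo-* q a b) ⟩
      ([ a ] + q ^ a * [ b ]) + q ^ a * q ^ b      ≈⟨ +-assoc _ _ _ ⟩
      [ a ] + (q ^ a * [ b ] + q ^ a * q ^ b)      ≈⟨ +-congˡ (distribˡ _ _ _) ⟨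
      [ a ] + q ^ a * [ suc b ]                    ∎

    n<k⇒qbinom≈0 : ∀ {n k} → n < k → qbinom n k ≈ 0#
    n<k⇒qbinom≈0 {zero}  {suc k} _         = refl
    n<k⇒qbinom≈0 {suc n} {suc k} (s≤s n<k) = begin
      qbinom n k + q ^ suc k * qbinom n (suc k) ≈⟨ +-cong (n<k⇒qbinom≈0 n<k)
                                                     (*-congˡ (n<k⇒qbinom≈0 (ℕ.m<n⇒m<1+n n<k))) ⟩
      0# + q ^ suc k * 0#                       ≈⟨ trans (+-identityˡ _) (zeroʳ _) ⟩
      0#                                        ∎

    qbinom-diagonal : ∀ n → qbinom n n ≈ 1#
    qbinom-diagonal zero    = refl
    qbinom-diagonal (suc n) = begin
      qbinom n n + q ^ suc n * qbinom n (suc n)  ≈⟨ +-cong (qbinom-diagonal n) (*-congˡ (n<k⇒qbinom≈0 (ℕ.n<1+n n))) ⟩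
      1# + q ^ suc n * 0#                        ≈⟨ trans (+-congˡ (zeroʳ _)) (+-identityʳ _) ⟩
      1#                                         ∎

    qbinom₂-zeroʳ : ∀ a → qbinom₂ a 0 ≈ 1#
    qbinom₂-zeroʳ a = trans (reflexive (≡.cong (λ n → qbinom n a) (ℕ.+-identityʳ a))) (qbinom-diagonal a)

    qbinom₂-pascal : ∀ a b → qbinom₂ (suc a) (suc b) ≈ qbinom₂ a (suc b) + q ^ suc a * qbinom₂ (suc a) b
    qbinom₂-pascal a b = +-congˡ (*-congˡ (reflexive (≡.cong (λ n → qbinom n (suc a)) (ℕ.+-suc a b))))

    [a]!*[b]!*qbinom₂≈[a+b]! : ∀ a b → [ a ]! * [ b ]! * qbinom₂ a b ≈ [ a ℕ.+ b ]!
    [a]!*[b]!*qbinom₂≈[a+b]! zero    b    = trans (*-identityʳ _) (*-identityˡ _)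
    [a]!*[b]!*qbinom₂≈[a+b]! (suc a) zero = begin
      [ suc a ]! * 1# * qbinom₂ (suc a) 0  ≈⟨ trans (*-congˡ (qbinom₂-zeroʳ (suc a))) (trans (*-identityʳ _) (*-identityʳ _)) ⟩
      [ suc a ]!                           ≈⟨ reflexive (≡.cong [_]! (ℕ.+-identityʳ (suc a))) ⟨
      [ suc a ℕ.+ 0 ]!                     ∎
    [a]!*[b]!*qbinom₂≈[a+b]! (suc a) (suc b) = begin
      [ suc a ]! * [ suc b ]! * qbinom₂ (suc a) (suc b)
        ≈⟨ *-congˡ (qbinom₂-pascal a b) ⟩
      ([ a ]! * [ suc a ]) * ([ b ]! * [ suc b ]) * (qbinom₂ a (suc b) + q ^ suc a * qbinom₂ (suc a) b)
        ≈⟨ solve 7 (λ a! [a+1] b! [b+1] x y qᵃ⁺¹ →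
                      (a! :* [a+1]) :* (b! :* [b+1]) :* (x :+ qᵃ⁺¹ :* y)
                   := [a+1] :* (a! :* (b! :* [b+1]) :* x) :+ (qᵃ⁺¹ :* [b+1]) :* (a! :* [a+1] :* b! :* y))
             refl [ a ]! [ suc a ] [ b ]! [ suc b ] (qbinom₂ a (suc b)) (qbinom₂ (suc a) b) (q ^ suc a) ⟩
      [ suc a ] * ([ a ]! * [ suc b ]! * qbinom₂ a (suc b)) + (q ^ suc a * [ suc b ]) * ([ suc a ]! * [ b ]! * qbinom₂ (suc a) b)
        ≈⟨ +-cong (*-congˡ ([a]!*[b]!*qbinom₂≈[a+b]! a (suc b)))
                  (*-congˡ (trans ([a]!*[b]!*qbinom₂≈[a+b]! (suc a) b) (reflexive (≡.cong [_]! (≡.sym (ℕ.+-suc a b)))))) ⟩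
      [ suc a ] * [ a ℕ.+ suc b ]! + (q ^ suc a * [ suc b ]) * [ a ℕ.+ suc b ]!
        ≈⟨ distribʳ _ _ _ ⟨
      ([ suc a ] + q ^ suc a * [ suc b ]) * [ a ℕ.+ suc b ]!
        ≈⟨ *-congʳ ([a+b]≈[a]+q^a*[b] (suc a) (suc b)) ⟨
      [ suc a ℕ.+ suc b ] * [ a ℕ.+ suc b ]!
        ≈⟨ *-comm _ _ ⟩
      [ suc a ℕ.+ suc b ]! ∎
      where open RingSolver commutativeSemiring

    qbinom₂-suc≈∑ : ∀ M m → qbinom₂ (suc M) m ≈ ∑ (suc m) (λ a → q ^ ((m ∸ a) ℕ.* suc M) * qbinom₂ M a)
    qbinom₂-suc≈∑ M zero    = trans (qbinom₂-zeroʳ (suc M)) (sym (trans (∑-1 _) (trans (*-identityˡ _) (qbinom₂-zeroʳ M))))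
    qbinom₂-suc≈∑ M (suc m) = begin
      qbinom₂ (suc M) (suc m)
        ≈⟨ qbinom₂-pascal M m ⟩
      qbinom₂ M (suc m) + q ^ suc M * qbinom₂ (suc M) m
        ≈⟨ +-congˡ (*-congˡ (qbinom₂-suc≈∑ M m)) ⟩
      qbinom₂ M (suc m) + q ^ suc M * ∑ (suc m) (λ a → q ^ ((m ∸ a) ℕ.* suc M) * qbinom₂ M a)
        ≈⟨ +-congˡ (trans (*-distribˡ-∑ (suc m) _ _) (∑-cong-< (suc m) λ a a≤m → shift a (ℕ.≤-pred a≤m))) ⟩
      qbinom₂ M (suc m) + ∑ (suc m) (λ a → q ^ ((suc m ∸ a) ℕ.* suc M) * qbinom₂ M a)
        ≈⟨ trans (+-comm _ _) (+-congˡ (sym last)) ⟩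
      ∑ (suc m) (λ a → q ^ ((suc m ∸ a) ℕ.* suc M) * qbinom₂ M a) + q ^ ((m ∸ m) ℕ.* suc M) * qbinom₂ M (suc m)
        ≈⟨ ∑-suc (suc m) _ ⟨
      ∑ (suc (suc m)) (λ a → q ^ ((suc m ∸ a) ℕ.* suc M) * qbinom₂ M a) ∎
      where
      shift : ∀ a → a ≤ m → q ^ suc M * (q ^ ((m ∸ a) ℕ.* suc M) * qbinom₂ M a)
                            ≈ q ^ ((suc m ∸ a) ℕ.* suc M) * qbinom₂ M a
      shift a a≤m = trans (sym (*-assoc _ _ _)) (*-congʳ (trans (sym (^-homo-* q (suc M) _))
                      (^-congʳ q (≡.cong (ℕ._* suc M) (≡.sym (ℕ.+-∸-assoc 1 a≤m))))))
      last : q ^ ((m ∸ m) ℕ.* suc M) * qbinom₂ M (suc m) ≈ qbinom₂ M (suc m)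
      last = trans (*-congʳ (^-congʳ q (≡.cong (ℕ._* suc M) (ℕ.n∸n≡0 m)))) (*-identityˡ _)

    ∏-geometric : ∀ j M m → ∏ (suc M) (λ r → geometric (r ℕ.+ j)) m ≈ q ^ (m ℕ.* suc j) * qbinom₂ M m
    ∏-geometric j zero    m = begin
      ∏ 1 (λ r → geometric (r ℕ.+ j)) m  ≈⟨ PowerSeries.⊛-identityˡ (geometric (suc j)) m ⟩
      q ^ (suc j ℕ.* m)                  ≈⟨ ^-congʳ q (ℕ.*-comm (suc j) m) ⟩
      q ^ (m ℕ.* suc j)                  ≈⟨ *-identityʳ _ ⟨
      q ^ (m ℕ.* suc j) * 1#             ∎
    ∏-geometric j (suc M) m = begin
      ∑ (suc m) (λ a → ∏ (suc M) (λ r → geometric (r ℕ.+ j)) a * q ^ ((suc (suc M) ℕ.+ j) ℕ.* (m ∸ a)))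
        ≈⟨ ∑-cong-< (suc m) (λ a a≤m → term a (ℕ.≤-pred a≤m)) ⟩
      ∑ (suc m) (λ a → q ^ (m ℕ.* suc j) * (q ^ ((m ∸ a) ℕ.* suc M) * qbinom₂ M a))
        ≈⟨ *-distribˡ-∑ (suc m) _ _ ⟨
      q ^ (m ℕ.* suc j) * ∑ (suc m) (λ a → q ^ ((m ∸ a) ℕ.* suc M) * qbinom₂ M a)
        ≈⟨ *-congˡ (qbinom₂-suc≈∑ M m) ⟨
      q ^ (m ℕ.* suc j) * qbinom₂ (suc M) m ∎
      where
      exponent : ∀ a → a ≤ m → a ℕ.* suc j ℕ.+ (suc (suc M) ℕ.+ j) ℕ.* (m ∸ a) ≡ m ℕ.* suc j ℕ.+ (m ∸ a) ℕ.* suc M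
      exponent a a≤m = ≡.trans (split a (m ∸ a)) (≡.cong (λ n → n ℕ.* suc j ℕ.+ (m ∸ a) ℕ.* suc M) (ℕ.m+[n∸m]≡n a≤m))
        where
        open ℕ-Solver.+-*-Solver
        split : ∀ a d → a ℕ.* suc j ℕ.+ (suc (suc M) ℕ.+ j) ℕ.* d ≡ (a ℕ.+ d) ℕ.* suc j ℕ.+ d ℕ.* suc M
        split a d = solve 4 (λ a d j M → a :* (con 1 :+ j) :+ (con 2 :+ M :+ j) :* d
                                      := (a :+ d) :* (con 1 :+ j) :+ d :* (con 1 :+ M)) ≡.refl a d j M
      term : ∀ a → a ≤ m → ∏ (suc M) (λ r → geometric (r ℕ.+ j)) a * q ^ ((suc (suc M) ℕ.+ j) ℕ.* (m ∸ a))
                           ≈ q ^ (m ℕ.* suc j) * (q ^ ((m ∸ a) ℕ.* suc M) * qbinom₂ M a)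
      term a a≤m = begin
        ∏ (suc M) (λ r → geometric (r ℕ.+ j)) a * q ^ ((suc (suc M) ℕ.+ j) ℕ.* (m ∸ a))
          ≈⟨ *-congʳ (∏-geometric j M a) ⟩
        q ^ (a ℕ.* suc j) * qbinom₂ M a * q ^ ((suc (suc M) ℕ.+ j) ℕ.* (m ∸ a))
          ≈⟨ xy∙z≈xz∙y _ _ _ ⟩
        q ^ (a ℕ.* suc j) * q ^ ((suc (suc M) ℕ.+ j) ℕ.* (m ∸ a)) * qbinom₂ M a
          ≈⟨ *-congʳ (trans (sym (^-homo-* q (a ℕ.* suc j) _))
                       (trans (^-congʳ q (exponent a a≤m)) (^-homo-* q (m ℕ.* suc j) ((m ∸ a) ℕ.* suc M)))) ⟩
        q ^ (m ℕ.* suc j) * q ^ ((m ∸ a) ℕ.* suc M) * qbinom₂ M a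
          ≈⟨ *-assoc _ _ _ ⟩
        q ^ (m ℕ.* suc j) * (q ^ ((m ∸ a) ℕ.* suc M) * qbinom₂ M a) ∎

    -1^k*q^kC2 : ℕ → Carrier
    -1^k*q^kC2 k = (- 1#) ^ k * q ^ (k C 2)

    -1^k*q^kC2-suc : ∀ k → -1^k*q^kC2 (suc k) ≈ - (q ^ k * -1^k*q^kC2 k)
    -1^k*q^kC2-suc k = begin
      - 1# * (- 1#) ^ k * q ^ (suc k C 2)           ≈⟨ *-cong (-1*x≈-x _) (^-congʳ q (suc[n]C2≡n+nC2 k)) ⟩
      - (- 1#) ^ k * q ^ (k ℕ.+ k C 2)              ≈⟨ *-congˡ (^-homo-* q k (k C 2)) ⟩
      - (- 1#) ^ k * (q ^ k * q ^ (k C 2))          ≈⟨ -‿distribˡ-* _ _ ⟨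
      - ((- 1#) ^ k * (q ^ k * q ^ (k C 2)))        ≈⟨ -‿cong (x∙yz≈y∙xz _ _ _) ⟩
      - (q ^ k * -1^k*q^kC2 k)                      ∎

    -- The q-binomial theorem ∏_{i<n} (1 + q^i x) = ∑_k q^(k C 2) [n k] x^k at x = -1; the
    -- q-Pascal rule makes the sum telescope.
    ∑-1^k*q^kC2*qbinom≈𝟙 : ∀ n → ∑ (suc n) (λ k → -1^k*q^kC2 k * qbinom n k) ≈ 𝟙 n
    ∑-1^k*q^kC2*qbinom≈𝟙 zero    = trans (∑-1 _) (trans (*-identityʳ _) (*-identityʳ _))
    ∑-1^k*q^kC2*qbinom≈𝟙 (suc m) = begin
      ∑ (suc (suc m)) (λ k → -1^k*q^kC2 k * qbinom (suc m) k)
        ≈⟨ ∑-sucˡ (suc m) _ ⟩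
      -1^k*q^kC2 0 * 1# + ∑ (suc m) (λ k → -1^k*q^kC2 (suc k) * qbinom (suc m) (suc k))
        ≈⟨ +-cong (*-congʳ (sym (*-identityˡ _))) (∑-cong (suc m) pascal) ⟩
      u 0 + ∑ (suc m) (λ k → - u k + u (suc k))
        ≈⟨ +-congˡ (trans (∑-distrib-+ (suc m) _ _) (+-congʳ (-‿distrib-∑ (suc m) u))) ⟩
      u 0 + (- ∑ (suc m) u + ∑ (suc m) (λ k → u (suc k)))
        ≈⟨ x+[y+z]≈y+[x+z] _ _ _ ⟩
      - ∑ (suc m) u + (u 0 + ∑ (suc m) (λ k → u (suc k)))
        ≈⟨ +-congˡ (∑-sucˡ (suc m) u) ⟨
      - ∑ (suc m) u + ∑ (suc (suc m)) u
        ≈⟨ +-congˡ (trans (∑-suc (suc m) u) (trans (+-congˡ last-vanishes) (+-identityʳ _))) ⟩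
      - ∑ (suc m) u + ∑ (suc m) u
        ≈⟨ -‿inverseˡ _ ⟩
      0# ∎
      where
      u : ℕ → Carrier
      u k = q ^ k * -1^k*q^kC2 k * qbinom m k
      pascal : ∀ k → -1^k*q^kC2 (suc k) * (qbinom m k + q ^ suc k * qbinom m (suc k)) ≈ - u k + u (suc k)
      pascal k = trans (distribˡ _ _ _) (+-cong
        (trans (*-congʳ (-1^k*q^kC2-suc k)) (sym (-‿distribˡ-* _ _)))
        (x∙yz≈yx∙z _ _ _))
      last-vanishes : u (suc m) ≈ 0#
      last-vanishes = trans (*-congˡ (n<k⇒qbinom≈0 (ℕ.n<1+n m))) (zeroʳ _)

    -1^j*-1^[j+k]≈-1^k : ∀ j k → (- 1#) ^ j * (- 1#) ^ (j ℕ.+ k) ≈ (- 1#) ^ k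
    -1^j*-1^[j+k]≈-1^k zero    k = *-identityˡ _
    -1^j*-1^[j+k]≈-1^k (suc j) k = begin
      - 1# * (- 1#) ^ j * (- 1# * (- 1#) ^ (j ℕ.+ k))  ≈⟨ *-cong (-1*x≈-x _) (-1*x≈-x _) ⟩
      - (- 1#) ^ j * - (- 1#) ^ (j ℕ.+ k)              ≈⟨ -‿distribˡ-* _ _ ⟨
      - ((- 1#) ^ j * - (- 1#) ^ (j ℕ.+ k))            ≈⟨ -‿cong (-‿distribʳ-* _ _) ⟨
      - - ((- 1#) ^ j * (- 1#) ^ (j ℕ.+ k))            ≈⟨ -‿involutive _ ⟩
      (- 1#) ^ j * (- 1#) ^ (j ℕ.+ k)                  ≈⟨ -1^j*-1^[j+k]≈-1^k j k ⟩
      (- 1#) ^ k                                       ∎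

    coefficient : ℕ → ℕ → Carrier
    coefficient j k = (- 1#) ^ j * (- 1#) ^ (j ℕ.+ k) * q ^ ((j ℕ.+ k ℕ.+ 1) C 2 ∸ (j ℕ.+ 1) C 2) * qbinom₂ j k

    coefficient-simplified : ∀ j k → coefficient j k ≈ -1^k*q^kC2 k * q ^ (k ℕ.* suc j) * qbinom₂ j k
    coefficient-simplified j k = *-congʳ (begin
      (- 1#) ^ j * (- 1#) ^ (j ℕ.+ k) * q ^ ((j ℕ.+ k ℕ.+ 1) C 2 ∸ (j ℕ.+ 1) C 2)
        ≈⟨ *-cong (-1^j*-1^[j+k]≈-1^k j k) (^-congʳ q ([j+k+1]C2∸[j+1]C2≡k*[1+j]+kC2 j k)) ⟩
      (- 1#) ^ k * q ^ (k ℕ.* suc j ℕ.+ k C 2)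
        ≈⟨ *-congˡ (trans (^-congʳ q (ℕ.+-comm (k ℕ.* suc j) (k C 2))) (^-homo-* q (k C 2) _)) ⟩
      (- 1#) ^ k * (q ^ (k C 2) * q ^ (k ℕ.* suc j))
        ≈⟨ *-assoc _ _ _ ⟨
      -1^k*q^kC2 k * q ^ (k ℕ.* suc j) ∎)

    module _ (cancel : ∀ n {x y} → [ n ]! * x ≈ [ n ]! * y → x ≈ y) where

      qbinom₂-unique : ∀ a b {x} → [ a ]! * [ b ]! * x ≈ [ a ℕ.+ b ]! → x ≈ qbinom₂ a b
      qbinom₂-unique a b {x} [a]!*[b]!*x≈[a+b]! = cancel b (cancel a (begin
        [ a ]! * ([ b ]! * x)               ≈⟨ *-assoc _ _ _ ⟨
        [ a ]! * [ b ]! * x                 ≈⟨ [a]!*[b]!*x≈[a+b]! ⟩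
        [ a ℕ.+ b ]!                        ≈⟨ [a]!*[b]!*qbinom₂≈[a+b]! a b ⟨
        [ a ]! * [ b ]! * qbinom₂ a b       ≈⟨ *-assoc _ _ _ ⟩
        [ a ]! * ([ b ]! * qbinom₂ a b)     ∎))

      -- Both sides are [j + k + l]! / ([j]! [k]! [l]!).
      qbinom₂-product : ∀ j k l → qbinom₂ j k * qbinom₂ (j ℕ.+ k) l ≈ qbinom₂ j (k ℕ.+ l) * qbinom₂ k l
      qbinom₂-product j k l = cancel j (cancel k (cancel l (trans lhs (sym rhs))))
        where
        open RingSolver commutativeSemiring
        lhs : [ l ]! * ([ k ]! * ([ j ]! * (qbinom₂ j k * qbinom₂ (j ℕ.+ k) l))) ≈ [ j ℕ.+ k ℕ.+ l ]!
        lhs = begin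
          [ l ]! * ([ k ]! * ([ j ]! * (qbinom₂ j k * qbinom₂ (j ℕ.+ k) l)))
            ≈⟨ solve 5 (λ l! k! j! x y → l! :* (k! :* (j! :* (x :* y))) := j! :* k! :* x :* l! :* y)
                 refl [ l ]! [ k ]! [ j ]! (qbinom₂ j k) (qbinom₂ (j ℕ.+ k) l) ⟩
          [ j ]! * [ k ]! * qbinom₂ j k * [ l ]! * qbinom₂ (j ℕ.+ k) l
            ≈⟨ *-congʳ (*-congʳ ([a]!*[b]!*qbinom₂≈[a+b]! j k)) ⟩
          [ j ℕ.+ k ]! * [ l ]! * qbinom₂ (j ℕ.+ k) l
            ≈⟨ [a]!*[b]!*qbinom₂≈[a+b]! (j ℕ.+ k) l ⟩
          [ j ℕ.+ k ℕ.+ l ]! ∎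
        rhs : [ l ]! * ([ k ]! * ([ j ]! * (qbinom₂ j (k ℕ.+ l) * qbinom₂ k l))) ≈ [ j ℕ.+ k ℕ.+ l ]!
        rhs = begin
          [ l ]! * ([ k ]! * ([ j ]! * (qbinom₂ j (k ℕ.+ l) * qbinom₂ k l)))
            ≈⟨ solve 5 (λ l! k! j! x y → l! :* (k! :* (j! :* (x :* y))) := j! :* (k! :* l! :* y) :* x)
                 refl [ l ]! [ k ]! [ j ]! (qbinom₂ j (k ℕ.+ l)) (qbinom₂ k l) ⟩
          [ j ]! * ([ k ]! * [ l ]! * qbinom₂ k l) * qbinom₂ j (k ℕ.+ l)
            ≈⟨ *-congʳ (*-congˡ ([a]!*[b]!*qbinom₂≈[a+b]! k l)) ⟩
          [ j ]! * [ k ℕ.+ l ]! * qbinom₂ j (k ℕ.+ l)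
            ≈⟨ [a]!*[b]!*qbinom₂≈[a+b]! j (k ℕ.+ l) ⟩
          [ j ℕ.+ (k ℕ.+ l) ]!
            ≈⟨ reflexive (≡.cong [_]! (ℕ.+-assoc j k l)) ⟨
          [ j ℕ.+ k ℕ.+ l ]! ∎

      coefficient*∏-geometric : ∀ j k l →
        coefficient j k * ∏ (j ℕ.+ k ℕ.+ 1) (λ r → geometric (r ℕ.+ j)) l
          ≈ q ^ ((k ℕ.+ l) ℕ.* suc j) * qbinom₂ j (k ℕ.+ l) * (-1^k*q^kC2 k * qbinom₂ k l)
      coefficient*∏-geometric j k l = begin
        coefficient j k * ∏ (j ℕ.+ k ℕ.+ 1) (λ r → geometric (r ℕ.+ j)) l
          ≈⟨ *-cong (coefficient-simplified j k)
                    (trans (reflexive (≡.cong (λ N → ∏ N (λ r → geometric (r ℕ.+ j)) l) (ℕ.+-comm (j ℕ.+ k) 1)))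
                           (∏-geometric j (j ℕ.+ k) l)) ⟩
        -1^k*q^kC2 k * q ^ (k ℕ.* suc j) * qbinom₂ j k * (q ^ (l ℕ.* suc j) * qbinom₂ (j ℕ.+ k) l)
          ≈⟨ solve 5 (λ a x y d e → a :* x :* d :* (y :* e) := x :* y :* (d :* e) :* a) refl _ _ _ _ _ ⟩
        q ^ (k ℕ.* suc j) * q ^ (l ℕ.* suc j) * (qbinom₂ j k * qbinom₂ (j ℕ.+ k) l) * -1^k*q^kC2 k
          ≈⟨ *-congʳ (*-cong (trans (sym (^-homo-* q (k ℕ.* suc j) (l ℕ.* suc j)))
                                    (^-congʳ q (≡.sym (ℕ.*-distribʳ-+ (suc j) k l))))
                             (qbinom₂-product j k l)) ⟩
        q ^ ((k ℕ.+ l) ℕ.* suc j) * (qbinom₂ j (k ℕ.+ l) * qbinom₂ k l) * -1^k*q^kC2 k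
          ≈⟨ solve 4 (λ x d e a → x :* (d :* e) :* a := x :* d :* (a :* e)) refl _ _ _ _ ⟩
        q ^ ((k ℕ.+ l) ℕ.* suc j) * qbinom₂ j (k ℕ.+ l) * (-1^k*q^kC2 k * qbinom₂ k l) ∎
        where open RingSolver commutativeSemiring

      ∑-coefficient*∏-geometric≈𝟙 : ∀ j n →
        ∑ (suc n) (λ k → coefficient j k * ∏ (j ℕ.+ k ℕ.+ 1) (λ r → geometric (r ℕ.+ j)) (n ∸ k)) ≈ 𝟙 n
      ∑-coefficient*∏-geometric≈𝟙 j n = begin
        ∑ (suc n) (λ k → coefficient j k * ∏ (j ℕ.+ k ℕ.+ 1) (λ r → geometric (r ℕ.+ j)) (n ∸ k))
          ≈⟨ ∑-cong-< (suc n) (λ k k≤n → term k (ℕ.≤-pred k≤n)) ⟩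
        ∑ (suc n) (λ k → scale n * (-1^k*q^kC2 k * qbinom n k))
          ≈⟨ *-distribˡ-∑ (suc n) _ _ ⟨
        scale n * ∑ (suc n) (λ k → -1^k*q^kC2 k * qbinom n k)
          ≈⟨ *-congˡ (∑-1^k*q^kC2*qbinom≈𝟙 n) ⟩
        scale n * 𝟙 n
          ≈⟨ scale*𝟙 n ⟩
        𝟙 n ∎
        where
        scale : ℕ → Carrier
        scale N = q ^ (N ℕ.* suc j) * qbinom₂ j N
        term : ∀ k → k ≤ n → coefficient j k * ∏ (j ℕ.+ k ℕ.+ 1) (λ r → geometric (r ℕ.+ j)) (n ∸ k)
                             ≈ scale n * (-1^k*q^kC2 k * qbinom n k)
        term k k≤n = trans (coefficient*∏-geometric j k (n ∸ k))
          (reflexive (≡.cong (λ N → scale N * (-1^k*q^kC2 k * qbinom N k)) (ℕ.m+[n∸m]≡n k≤n)))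
        scale*𝟙 : ∀ n → scale n * 𝟙 n ≈ 𝟙 n
        scale*𝟙 zero    = trans (*-identityʳ _) (trans (*-identityˡ _) (qbinom₂-zeroʳ j))
        scale*𝟙 (suc n) = zeroʳ _

open import Defs
open import Data.Nat using (ℕ; _+_; _∸_; _≤_)
open import Data.Nat.Combinatorics using (_C_)
open import Data.Integer as ℤ using (1ℤ)
import Data.Integer.Properties as ℤ

module ℤ[q] = Summation ℤ.+-*-commutativeRing sumℤ (λ _ → ≡.refl) (λ _ _ → ≡.refl)
open ℤ[q].PowerSeries using (X; X⊛-constant; X⊛-suc; ⊛-constant; ⊛-cong; ⊛-congʳ; ⊛-cancelˡ)

polynomialRing : CommutativeRing _ _
polynomialRing = ℤ[q].PowerSeries.commutativeRing

open CommutativeRing polynomialRing using (0#; 1#; -_)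

0P≈0# : 0P ≈P 0#
0P≈0# zero    = ≡.refl
0P≈0# (suc _) = ≡.refl

1P≈1# : 1P ≈P 1#
1P≈1# zero    = ≡.refl
1P≈1# (suc _) = ≡.refl

module ℤ[q][[y]] = Summation polynomialRing sumP (λ _ → 0P≈0#) (λ _ _ _ → ≡.refl)
open ℤ[q][[y]] using (∑-cong)
open ℤ[q][[y]].PowerSeries using (∏; 𝟙)
open ℤ[q][[y]].Gaussian X
open import Algebra.Properties.Semiring.Exp (CommutativeRing.semiring polynomialRing) using (_^_)
open RingProperties (CommutativeRing.ring polynomialRing) using (-1*x≈-x)

qpow≈X^ : ∀ e → qpow e ≈P X ^ e
qpow≈X^ zero    zero    = ≡.refl
qpow≈X^ zero    (suc m) = ≡.refl
qpow≈X^ (suc e) zero    = ≡.sym (X⊛-constant (X ^ e))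
qpow≈X^ (suc e) (suc m) = ≡.trans (qpow≈X^ e m) (≡.sym (X⊛-suc (X ^ e) m))

qint≈[_] : ∀ m → qint m ≈P [ m ]
qint≈[ zero  ]   = 0P≈0#
qint≈[ suc m ] i = ≡.cong₂ ℤ._+_ (qint≈[ m ] i) (qpow≈X^ m i)

qfact≈[_]! : ∀ m → qfact m ≈P [ m ]!
qfact≈[ zero  ]! = 1P≈1#
qfact≈[ suc m ]! = ⊛-cong qfact≈[ m ]! qint≈[ suc m ]

negPow≈-1^ : ∀ k → constP (negPow k) ≈P (- 1#) ^ k
negPow≈-1^ zero      = 1P≈1#
negPow≈-1^ (suc k) i =
  ≡.trans (constP-neg i) (≡.trans (≡.cong ℤ.-_ (negPow≈-1^ k i)) (≡.sym (-1*x≈-x ((- 1#) ^ k) i)))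
  where
  constP-neg : ∀ i → constP (ℤ.- negPow k) i ≡ ℤ.- constP (negPow k) i
  constP-neg zero    = ≡.refl
  constP-neg (suc _) = ≡.refl

1S≈𝟙 : 1S ≈S 𝟙
1S≈𝟙 zero    = 1P≈1#
1S≈𝟙 (suc _) = 0P≈0#

prodS≈∏ : ∀ N {F F′} → (∀ r → F r ≈S F′ r) → prodS N F ≈S ∏ N F′
prodS≈∏ zero    F≈F′ = 1S≈𝟙
prodS≈∏ (suc N) F≈F′ = ℤ[q][[y]].PowerSeries.⊛-cong (prodS≈∏ N F≈F′) (F≈F′ (suc N))

[1+n]-constant : ∀ n → [ suc n ] 0 ≡ 1ℤ
[1+n]-constant zero    = ≡.refl
[1+n]-constant (suc n) = ≡.cong₂ ℤ._+_ ([1+n]-constant n) (X⊛-constant (X ^ n))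

[n]!-constant : ∀ n → [ n ]! 0 ≡ 1ℤ
[n]!-constant zero    = ≡.refl
[n]!-constant (suc n) = ≡.trans (⊛-constant [ n ]! [ suc n ]) (≡.cong₂ ℤ._*_ ([n]!-constant n) ([1+n]-constant n))

[n]!-cancelˡ : ∀ n {x y} → [ n ]! *P x ≈P [ n ]! *P y → x ≈P y
[n]!-cancelˡ n = ⊛-cancelˡ {f = [ n ]!} ([n]!-constant n)

G≈qbinom₂ : ∀ j (G : ℕ → Pol) → (∀ i → j ≤ i → (qfact j *P qfact (i ∸ j)) *P G i ≈P qfact i)
          → ∀ k → G (j + k) ≈P qbinom₂ j k
G≈qbinom₂ j G G-factorial k = qbinom₂-unique [n]!-cancelˡ j k (begin
  [ j ]! *P [ k ]! *P G (j + k)                   ≈⟨ ⊛-congʳ (G (j + k)) (⊛-cong qfact≈[ j ]! k!≈) ⟨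
  qfact j *P qfact (j + k ∸ j) *P G (j + k)       ≈⟨ G-factorial (j + k) (ℕ.m≤m+n j k) ⟩
  qfact (j + k)                                   ≈⟨ qfact≈[ j + k ]! ⟩
  [ j + k ]!                                      ∎)
  where
  open import Relation.Binary.Reasoning.Setoid (CommutativeRing.setoid polynomialRing)
  k!≈ : qfact (j + k ∸ j) ≈P [ k ]!
  k!≈ i = ≡.trans (qfact≈[ j + k ∸ j ]! i) (≡.cong (λ n → [ n ]! i) (ℕ.m+n∸m≡n j k))

lemma4p13 : (j : ℕ) (G : ℕ → Pol)
    → (∀ i → j ≤ i → (qfact j *P qfact (i ∸ j)) *P G i ≈P qfact i)
    → sumY (λ k → scaleS (constP (negPow j) *P constP (negPow (j + k))
                           *P qpow (((j + k + 1) C 2) ∸ ((j + 1) C 2))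
                           *P G (j + k))
                          (prodS (j + k + 1) (λ r → geomS (r + j))))
      ≈S 1S
lemma4p13 j G G-factorial n = begin
  _
    ≈⟨ ∑-cong (suc n) (λ k → ⊛-cong (coefficient≈ k) (prodS≈∏ (j + k + 1) geomS≈geometric (n ∸ k))) ⟩
  sumP (suc n) (λ k → coefficient j k *P ∏ (j + k + 1) (λ r → geometric (r + j)) (n ∸ k))
    ≈⟨ ∑-coefficient*∏-geometric≈𝟙 [n]!-cancelˡ j n ⟩
  𝟙 n
    ≈⟨ 1S≈𝟙 n ⟨
  1S n ∎
  where
  open import Relation.Binary.Reasoning.Setoid (CommutativeRing.setoid polynomialRing)
  coefficient≈ : ∀ k → constP (negPow j) *P constP (negPow (j + k)) *P qpow ((j + k + 1) C 2 ∸ (j + 1) C 2) *P G (j + k)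
                       ≈P coefficient j k
  coefficient≈ k = ⊛-cong (⊛-cong (⊛-cong (negPow≈-1^ j) (negPow≈-1^ (j + k))) (qpow≈X^ _)) (G≈qbinom₂ j G G-factorial k)
  geomS≈geometric : ∀ r → geomS (r + j) ≈S geometric (r + j)
  geomS≈geometric r m = qpow≈X^ ((r + j) ℕ.* m)
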